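{- For every integer $n\ge1$, $\widehat{C}_{5,8,n}=2^{n-1}$.
   Context: A $5$-dimensional balanced ballot path of length $5n$ is a sequence of $5n$ standard unit vectors of $\mathbb{R}^5$, each $\vec e_i$ occurring exactly $n$ times, such that every intermediate point (partial sum) $(x_1,\dots,x_5)$ satisfies $x_1\ge\cdots\ge x_5$. The semisymmetric height of a point is $g_5(\vec x)=4x_1+2x_2-2x_4-4x_5$, and the semisymmetric height of a path is the maximum of $g_5$ over its intermediate points. $\widehat{C}_{5,u,n}$ is the number of $5$-dimensional balanced ballot paths of length $5n$ with semisymmetric height at most $u$. -}

module Defs where

open import Data.Nat using (ℕ; zero; suc; _+_; _*_; _≤_; _≟_; _≤?_)
open import Data.Fin using (Fin; #_)
open import Data.Fin.Properties using () renaming (_≟_ to _≟ᶠ_)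
open import Data.List using (List; []; _∷_; map; concatMap; length; filter; inits; sum)
open import Data.List.Relation.Unary.All using (All; all?)
open import Data.Product using (_×_; _,_)
open import Relation.Nullary using (Dec; yes; no; ¬_)
open import Relation.Nullary.Decidable using (_×-dec_)
open import Relation.Binary.PropositionalEquality using (_≡_)
open import Data.Vec.Functional using (Vector)
import Data.List as L

-- A step of a 5-dimensional lattice path is a standard unit vector e_i, i ∈ Fin 5.
-- A path is the list of its steps.
Path : Set
Path = List (Fin 5)

occ : Fin 5 → Path → ℕ
occ i w = length (filter (λ j → j ≟ᶠ i) w)

point : Path → Vector ℕ 5
point w i = occ i w

Ballot : Vector ℕ 5 → Set
Ballot x = (x (# 4) ≤ x (# 3)) × (x (# 3) ≤ x (# 2)) × (x (# 2) ≤ x (# 1)) × (x (# 1) ≤ x (# 0))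

-- g₅(x) = 4x1 + 2x2 - 2x4 - 4x5 ≤ u, written without subtraction:
-- 4x1 + 2x2 ≤ u + 2x4 + 4x5.
HeightAtMost : ℕ → Vector ℕ 5 → Set
HeightAtMost u x = 4 * x (# 0) + 2 * x (# 1) ≤ u + 2 * x (# 3) + 4 * x (# 4)

Balanced : ℕ → Path → Set
Balanced n w = All (λ i → occ i w ≡ n) (L.allFin 5)

-- w is a 5-dim balanced ballot path of length 5n (the length is forced by
-- generation below) with semisymmetric height ≤ u: every intermediate point
-- (point after each prefix, including the start and the end) is ballot and
-- has g₅ ≤ u.
Good : ℕ → ℕ → Path → Set
Good u n w = Balanced n w × All (λ p → Ballot (point p) × HeightAtMost u (point p)) (inits w)

good? : (u n : ℕ) → (w : Path) → Dec (Good u n w)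
good? u n w =
  all? (λ i → occ i w ≟ n) (L.allFin 5)
  ×-dec all? (λ p → let x = point p in
                 ((x (# 4) ≤? x (# 3)) ×-dec (x (# 3) ≤? x (# 2))
                  ×-dec (x (# 2) ≤? x (# 1)) ×-dec (x (# 1) ≤? x (# 0)))
                 ×-dec (4 * x (# 0) + 2 * x (# 1) ≤? u + 2 * x (# 3) + 4 * x (# 4)))
             (inits w)

words : ℕ → List Path
words zero = [] ∷ []
words (suc k) = concatMap (λ w → L.map (_∷ w) (L.allFin 5)) (words k)

Chat5 : ℕ → ℕ → ℕ
Chat5 u n = length (filter (good? u n) (words (5 * n)))

-- Translating a point along (1,1,1,1,1) changes neither the ballot condition nor
-- g₅ (its coefficients sum to 0), so whether a path can be continued depends only
-- on its current point modulo the diagonal. Under height 8 only seven classes are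
-- reachable, with representatives (0,0,0,0,0), (1,0,0,0,0), (2,0,0,0,0),
-- (1,1,0,0,0), (1,1,1,0,0), (1,1,1,1,0) and (2,1,1,1,0), and they form a finite
-- automaton. After the forced first step e₁, a path returns to the class of
-- (1,0,0,0,0) only by e₂e₃e₄ followed by e₁e₅ or e₅e₁, and reaches the diagonal
-- only by e₂e₃e₄e₅, while (2,0,0,0,0) is a dead end. So a balanced path of length
-- 5n is determined by n − 1 binary choices.
module Submission where

open import Defs
open import Data.Nat using (ℕ; _≤_; _^_; _∸_)
open import Relation.Binary.PropositionalEquality using (_≡_)

open import Algebra.Properties.CommutativeSemigroup using (interchange)
open import Data.Bool using (Bool; true; false; T)
open import Data.Fin using (Fin; #_) renaming (zero to fzero; suc to fsuc)
open import Data.Fin.Properties using (all?) renaming (_≟_ to _≟ᶠ_)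
open import Data.List using (List; []; _∷_; _++_; map; concatMap; length; filter; inits; allFin)
open import Data.List.Membership.Propositional.Properties using (∈-allFin)
open import Data.List.Properties using (map-cong; map-cong-local; map-++)
open import Data.List.Relation.Unary.All as All using (All; []; _∷_)
open import Data.List.Relation.Unary.All.Properties using (map⁺; map⁻; concat⁺)
open import Data.Maybe using (Maybe; just; nothing)
open import Data.Nat using (zero; suc; _+_; _*_; _≟_; _≤?_)
open import Data.Nat.ListAction using (sum)
open import Data.Nat.ListAction.Properties using (sum-++)
open import Data.Nat.Properties
  using (+-assoc; +-identityʳ; +-cancelˡ-≤; +-monoʳ-≤; +-cancelˡ-≡; *-cancelˡ-≡; *-suc; +-commutativeSemigroup)
open import Data.Nat.Tactic.RingSolver using (solve-∀)
open import Data.Product using (_×_; _,_; proj₁; proj₂; ∃-syntax)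
open import Data.Product.Function.NonDependent.Propositional using (_×-⇔_)
open import Data.Vec as Vec using (_∷_; [])
open import Data.Vec.Functional using (Vector; fromVec; zipWith)
open import Data.Vec.Properties using (tabulate-cong)
open import Function using (_∘_)
open import Function.Bundles using (_⇔_; mk⇔; Equivalence)
open import Function.Properties.Equivalence using () renaming (trans to ⇔-trans)
open import Relation.Binary.PropositionalEquality
  using (refl; sym; trans; cong; cong₂; subst; _≗_; module ≡-Reasoning)
open import Relation.Nullary using (Dec; does; isYes; ¬_; ¬?)
open import Relation.Nullary.Decidable using (_×-dec_; from-yes; toWitness; fromWitness; does-⇔; T?)
open import Relation.Unary using (Decidable)

open Equivalence using (to; from)

private
  variable
    u m n : ℕ
    x y : Vector ℕ 5
    j : Fin 5
    w : Path

Admissible : ℕ → Vector ℕ 5 → Set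
Admissible u x = Ballot x × HeightAtMost u x

Diagonal : Vector ℕ 5 → Set
Diagonal x = ∀ i → x i ≡ x (# 0)

admissible? : ∀ u x → Dec (Admissible u x)
admissible? u x =
  ((x (# 4) ≤? x (# 3)) ×-dec (x (# 3) ≤? x (# 2)) ×-dec (x (# 2) ≤? x (# 1)) ×-dec (x (# 1) ≤? x (# 0)))
  ×-dec (4 * x (# 0) + 2 * x (# 1) ≤? u + 2 * x (# 3) + 4 * x (# 4))

diagonal? : ∀ x → Dec (Diagonal x)
diagonal? x = all? (λ i → x i ≟ x (# 0))

infix 4 _≗?_
_≗?_ : (x y : Vector ℕ 5) → Dec (x ≗ y)
x ≗? y = all? (λ i → x i ≟ y i)

infix 4 _≈_
_≈_ : Vector ℕ 5 → Vector ℕ 5 → Set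
x ≈ y = ∃[ m ] x ≗ (λ i → m + y i)

+-cancel-≤⇔ : ∀ k {a b a′ b′} → a ≡ k + a′ → b ≡ k + b′ → a ≤ b ⇔ a′ ≤ b′
+-cancel-≤⇔ k refl refl = mk⇔ (+-cancelˡ-≤ k _ _) (+-monoʳ-≤ k)

ballot-shift : Ballot (λ i → m + x i) ⇔ Ballot x
ballot-shift {m} = cancel ×-⇔ cancel ×-⇔ cancel ×-⇔ cancel
  where
  cancel : ∀ {a b} → m + a ≤ m + b ⇔ a ≤ b
  cancel = +-cancel-≤⇔ m refl refl

heightAtMost-shift : HeightAtMost u (λ i → m + x i) ⇔ HeightAtMost u x
heightAtMost-shift {u} {m} = +-cancel-≤⇔ (6 * m) (lhs m _ _) (rhs u m _ _)
  where
  lhs : ∀ m a b → 4 * (m + a) + 2 * (m + b) ≡ 6 * m + (4 * a + 2 * b)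
  lhs = solve-∀
  rhs : ∀ u m c d → u + 2 * (m + c) + 4 * (m + d) ≡ 6 * m + (u + 2 * c + 4 * d)
  rhs = solve-∀

diagonal-shift : Diagonal (λ i → m + x i) ⇔ Diagonal x
diagonal-shift {m} = mk⇔ (λ d i → +-cancelˡ-≡ m _ _ (d i)) (λ d i → cong (m +_) (d i))

-- Admissible u x only reads the coordinates x (# i), so it is definitionally
-- Admissible u (Vec.lookup (Vec.tabulate x)).
admissible-resp : ∀ u → x ≗ y → Admissible u x → Admissible u y
admissible-resp u x≗y = subst (Admissible u ∘ Vec.lookup) (tabulate-cong x≗y)

diagonal-resp : x ≗ y → Diagonal x → Diagonal y
diagonal-resp x≗y d i = trans (sym (x≗y i)) (trans (d i) (x≗y (# 0)))

admissible-≈ : ∀ u → x ≈ y → Admissible u x ⇔ Admissible u y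
admissible-≈ {y = y} u (m , e) =
  ⇔-trans (mk⇔ (admissible-resp u e) (admissible-resp u (sym ∘ e)))
          (ballot-shift {m} {y} ×-⇔ heightAtMost-shift {u} {m} {y})

diagonal-≈ : x ≈ y → Diagonal x ⇔ Diagonal y
diagonal-≈ {y = y} (m , e) =
  ⇔-trans (mk⇔ (diagonal-resp e) (diagonal-resp (sym ∘ e))) (diagonal-shift {m} {y})

infixl 6 _+ᵛ_ _⊕_
_+ᵛ_ : Vector ℕ 5 → Vector ℕ 5 → Vector ℕ 5
_+ᵛ_ = zipWith _+_

_⊕_ : Vector ℕ 5 → Fin 5 → Vector ℕ 5
x ⊕ j = x +ᵛ point (j ∷ [])

GoodFrom : ℕ → Vector ℕ 5 → Path → Set
GoodFrom u x []      = Admissible u x × Diagonal x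
GoodFrom u x (j ∷ w) = Admissible u x × GoodFrom u (x ⊕ j) w

goodFrom⇒admissible : GoodFrom u x w → Admissible u x
goodFrom⇒admissible {w = []}    = proj₁
goodFrom⇒admissible {w = _ ∷ _} = proj₁

≈-⊕ : x ≈ y → x ⊕ j ≈ y ⊕ j
≈-⊕ {y = y} {j} (m , e) = m , λ i → trans (cong (_+ point (j ∷ []) i) (e i)) (+-assoc m (y i) _)

goodFrom-≈ : ∀ u → x ≈ y → GoodFrom u x w ⇔ GoodFrom u y w
goodFrom-≈ {w = []}    u x≈y = admissible-≈ u x≈y ×-⇔ diagonal-≈ x≈y
goodFrom-≈ {w = j ∷ w} u x≈y = admissible-≈ u x≈y ×-⇔ goodFrom-≈ u (≈-⊕ {j = j} x≈y)

point-∷ : ∀ j p → point (j ∷ p) ≗ point (j ∷ []) +ᵛ point p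
point-∷ j p i with does (j ≟ᶠ i)
... | true  = refl
... | false = refl

+ᵛ-point-[] : ∀ x → x +ᵛ point [] ≗ x
+ᵛ-point-[] x i = +-identityʳ (x i)

+ᵛ-point-∷ : ∀ x j p → x +ᵛ point (j ∷ p) ≗ x ⊕ j +ᵛ point p
+ᵛ-point-∷ x j p i = trans (cong (x i +_) (point-∷ j p i)) (sym (+-assoc (x i) _ _))

goodFrom⇔inits : ∀ u x w →
  GoodFrom u x w ⇔ (All (λ p → Admissible u (x +ᵛ point p)) (inits w) × Diagonal (x +ᵛ point w))
goodFrom⇔inits u x [] = mk⇔
  (λ (a , d) → (admissible-resp u (sym ∘ +ᵛ-point-[] x) a ∷ []) , diagonal-resp (sym ∘ +ᵛ-point-[] x) d)
  (λ { ((a ∷ []) , d) → admissible-resp u (+ᵛ-point-[] x) a , diagonal-resp (+ᵛ-point-[] x) d })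
goodFrom⇔inits u x (j ∷ w) = mk⇔
  (λ (a , g) → let (as , d) = to (goodFrom⇔inits u (x ⊕ j) w) g in
    (admissible-resp u (sym ∘ +ᵛ-point-[] x) a
      ∷ map⁺ (All.map (λ {p} → admissible-resp u (sym ∘ +ᵛ-point-∷ x j p)) as))
    , diagonal-resp (sym ∘ +ᵛ-point-∷ x j w) d)
  (λ { ((a ∷ as) , d) →
    admissible-resp u (+ᵛ-point-[] x) a
    , from (goodFrom⇔inits u (x ⊕ j) w)
        ( All.map (λ {p} → admissible-resp u (+ᵛ-point-∷ x j p)) (map⁻ as)
        , diagonal-resp (+ᵛ-point-∷ x j w) d) })

sum-map-zero : ∀ {A : Set} (xs : List A) → sum (map (λ _ → 0) xs) ≡ 0
sum-map-zero []       = refl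
sum-map-zero (_ ∷ xs) = sum-map-zero xs

sum-map-+ : ∀ {A : Set} (f g : A → ℕ) xs →
  sum (map (λ a → f a + g a) xs) ≡ sum (map f xs) + sum (map g xs)
sum-map-+ f g []       = refl
sum-map-+ f g (a ∷ xs) = begin
  f a + g a + sum (map (λ a → f a + g a) xs)     ≡⟨ cong (f a + g a +_) (sum-map-+ f g xs) ⟩
  f a + g a + (sum (map f xs) + sum (map g xs))  ≡⟨ interchange +-commutativeSemigroup (f a) (g a) _ _ ⟩
  f a + sum (map f xs) + (g a + sum (map g xs))  ∎
  where open ≡-Reasoning

sum-map-comm : ∀ {A B : Set} (f : A → B → ℕ) xs ys →
  sum (map (λ a → sum (map (f a) ys)) xs) ≡ sum (map (λ b → sum (map (λ a → f a b) xs)) ys)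
sum-map-comm f []       ys = sym (sum-map-zero ys)
sum-map-comm f (a ∷ xs) ys = begin
  sum (map (f a) ys) + sum (map (λ a → sum (map (f a) ys)) xs)
    ≡⟨ cong (sum (map (f a) ys) +_) (sum-map-comm f xs ys) ⟩
  sum (map (f a) ys) + sum (map (λ b → sum (map (λ a → f a b) xs)) ys)
    ≡⟨ sum-map-+ (f a) (λ b → sum (map (λ a → f a b) xs)) ys ⟨
  sum (map (λ b → f a b + sum (map (λ a → f a b) xs)) ys)
    ∎
  where open ≡-Reasoning

sum-map-concatMap : ∀ {A B : Set} (f : B → ℕ) (g : A → List B) xs →
  sum (map f (concatMap g xs)) ≡ sum (map (λ a → sum (map f (g a))) xs)
sum-map-concatMap f g []       = refl
sum-map-concatMap f g (a ∷ xs) = begin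
  sum (map f (g a ++ concatMap g xs))               ≡⟨ cong sum (map-++ f (g a) _) ⟩
  sum (map f (g a) ++ map f (concatMap g xs))       ≡⟨ sum-++ (map f (g a)) _ ⟩
  sum (map f (g a)) + sum (map f (concatMap g xs))  ≡⟨ cong (sum (map f (g a)) +_) (sum-map-concatMap f g xs) ⟩
  sum (map f (g a)) + sum (map (λ a → sum (map f (g a))) xs) ∎
  where open ≡-Reasoning

toℕ : Bool → ℕ
toℕ false = 0
toℕ true  = 1

length-filter≡sum : ∀ {A : Set} {P : A → Set} (P? : Decidable P) xs →
  length (filter P? xs) ≡ sum (map (toℕ ∘ does ∘ P?) xs)
length-filter≡sum P? []       = refl
length-filter≡sum P? (x ∷ xs) with does (P? x)
... | true  = cong suc (length-filter≡sum P? xs)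
... | false = length-filter≡sum P? xs

sum-point-[_] : ∀ j → sum (map (point (j ∷ [])) (allFin 5)) ≡ 1
sum-point-[_] = from-yes (all? λ j → sum (map (point (j ∷ [])) (allFin 5)) ≟ 1)

sum-point : ∀ w → sum (map (point w) (allFin 5)) ≡ length w
sum-point []      = refl
sum-point (j ∷ w) = begin
  sum (map (point (j ∷ w)) (allFin 5))
    ≡⟨ cong sum (map-cong (point-∷ j w) (allFin 5)) ⟩
  sum (map (point (j ∷ []) +ᵛ point w) (allFin 5))
    ≡⟨ sum-map-+ (point (j ∷ [])) (point w) (allFin 5) ⟩
  sum (map (point (j ∷ [])) (allFin 5)) + sum (map (point w) (allFin 5))
    ≡⟨ cong₂ _+_ sum-point-[ j ] (sum-point w) ⟩
  suc (length w)
    ∎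
  where open ≡-Reasoning

balanced⇔diagonal : ∀ w → length w ≡ 5 * n → Balanced n w ⇔ Diagonal (point w)
balanced⇔diagonal {n} w len = mk⇔
  (λ b i → trans (All.lookup b (∈-allFin i)) (sym (All.lookup b (∈-allFin (# 0)))))
  (λ d → All.tabulate (λ {i} _ → trans (d i) (occ₀≡n d)))
  where
  open ≡-Reasoning
  occ₀≡n : Diagonal (point w) → occ (# 0) w ≡ n
  occ₀≡n d = *-cancelˡ-≡ _ _ 5 (begin
    5 * occ (# 0) w                 ≡⟨ cong sum (map-cong d (allFin 5)) ⟨
    sum (map (point w) (allFin 5))  ≡⟨ sum-point w ⟩
    length w                        ≡⟨ len ⟩
    5 * n                           ∎)

good⇔goodFrom : ∀ u w → length w ≡ 5 * n → Good u n w ⇔ GoodFrom u (point []) w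
good⇔goodFrom u w len = mk⇔
  (λ (b , as) → from (goodFrom⇔inits u (point []) w) (as , to (balanced⇔diagonal w len) b))
  (λ g → let (as , d) = to (goodFrom⇔inits u (point []) w) g in from (balanced⇔diagonal w len) d , as)

data State : Set where
  ⟨00000⟩ ⟨10000⟩ ⟨20000⟩ ⟨11000⟩ ⟨11100⟩ ⟨11110⟩ ⟨21110⟩ : State

shape : State → Vector ℕ 5
shape ⟨00000⟩ = fromVec (0 ∷ 0 ∷ 0 ∷ 0 ∷ 0 ∷ [])
shape ⟨10000⟩ = fromVec (1 ∷ 0 ∷ 0 ∷ 0 ∷ 0 ∷ [])
shape ⟨20000⟩ = fromVec (2 ∷ 0 ∷ 0 ∷ 0 ∷ 0 ∷ [])
shape ⟨11000⟩ = fromVec (1 ∷ 1 ∷ 0 ∷ 0 ∷ 0 ∷ [])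
shape ⟨11100⟩ = fromVec (1 ∷ 1 ∷ 1 ∷ 0 ∷ 0 ∷ [])
shape ⟨11110⟩ = fromVec (1 ∷ 1 ∷ 1 ∷ 1 ∷ 0 ∷ [])
shape ⟨21110⟩ = fromVec (2 ∷ 1 ∷ 1 ∷ 1 ∷ 0 ∷ [])

pattern e₁ = fzero
pattern e₂ = fsuc e₁
pattern e₃ = fsuc e₂
pattern e₄ = fsuc e₃
pattern e₅ = fsuc e₄

next : State → Fin 5 → Maybe State
next ⟨00000⟩ e₁ = just ⟨10000⟩
next ⟨10000⟩ e₁ = just ⟨20000⟩
next ⟨10000⟩ e₂ = just ⟨11000⟩
next ⟨11000⟩ e₃ = just ⟨11100⟩
next ⟨11100⟩ e₄ = just ⟨11110⟩
next ⟨11110⟩ e₁ = just ⟨21110⟩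
next ⟨11110⟩ e₅ = just ⟨00000⟩
next ⟨21110⟩ e₅ = just ⟨10000⟩
next _       _  = nothing

accepts : Maybe State → Path → Bool
accepts nothing  _       = false
accepts (just s) []      = isYes (diagonal? (shape s))
accepts (just s) (j ∷ w) = accepts (next s j) w

-- Every shape has last coordinate 0, so a successor shape is a translate of
-- shape s ⊕ j by the last coordinate of the latter.
TransitionSpec : State → Fin 5 → Maybe State → Set
TransitionSpec s j (just s′) = shape s ⊕ j ≗ (λ i → (shape s ⊕ j) (# 4) + shape s′ i)
TransitionSpec s j nothing   = ¬ Admissible 8 (shape s ⊕ j)

transitionSpec? : ∀ s j q → Dec (TransitionSpec s j q)
transitionSpec? s j (just s′) = shape s ⊕ j ≗? (λ i → (shape s ⊕ j) (# 4) + shape s′ i)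
transitionSpec? s j nothing   = ¬? (admissible? 8 (shape s ⊕ j))

StateSpec : State → Set
StateSpec s = Admissible 8 (shape s) × (∀ j → TransitionSpec s j (next s j))

stateSpec? : ∀ s → Dec (StateSpec s)
stateSpec? s = admissible? 8 (shape s) ×-dec all? (λ j → transitionSpec? s j (next s j))

state-spec : ∀ s → StateSpec s
state-spec ⟨00000⟩ = from-yes (stateSpec? ⟨00000⟩)
state-spec ⟨10000⟩ = from-yes (stateSpec? ⟨10000⟩)
state-spec ⟨20000⟩ = from-yes (stateSpec? ⟨20000⟩)
state-spec ⟨11000⟩ = from-yes (stateSpec? ⟨11000⟩)
state-spec ⟨11100⟩ = from-yes (stateSpec? ⟨11100⟩)
state-spec ⟨11110⟩ = from-yes (stateSpec? ⟨11110⟩)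
state-spec ⟨21110⟩ = from-yes (stateSpec? ⟨21110⟩)

goodFrom⇔accepts : ∀ s w → GoodFrom 8 (shape s) w ⇔ T (accepts (just s) w)
goodFrom⇔accepts s [] = mk⇔
  (fromWitness {a? = diagonal? (shape s)} ∘ proj₂)
  (λ t → proj₁ (state-spec s) , toWitness {a? = diagonal? (shape s)} t)
goodFrom⇔accepts s (j ∷ w) with next s j | proj₂ (state-spec s) j
... | just s′ | e = mk⇔
  (to (goodFrom⇔accepts s′ w) ∘ to (goodFrom-≈ 8 (_ , e)) ∘ proj₂)
  (λ t → proj₁ (state-spec s) , from (goodFrom-≈ 8 (_ , e)) (from (goodFrom⇔accepts s′ w) t))
... | nothing | ¬admissible = mk⇔ (¬admissible ∘ goodFrom⇒admissible ∘ proj₂) λ ()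

good⇔accepts : ∀ w → length w ≡ 5 * n → Good 8 n w ⇔ T (accepts (just ⟨00000⟩) w)
good⇔accepts w len =
  ⇔-trans (good⇔goodFrom 8 w len) (⇔-trans (goodFrom-≈ 8 origin≈) (goodFrom⇔accepts ⟨00000⟩ w))
  where
  origin≈ : point [] ≈ shape ⟨00000⟩
  origin≈ = 0 , from-yes (point [] ≗? shape ⟨00000⟩)

acceptedCount : Maybe State → ℕ → ℕ
acceptedCount nothing  _       = 0
acceptedCount (just s) zero    = toℕ (accepts (just s) [])
acceptedCount (just s) (suc k) = sum (map (λ j → acceptedCount (next s j) k) (allFin 5))

sum-words-suc : ∀ (f : Path → ℕ) k →
  sum (map f (words (suc k))) ≡ sum (map (λ j → sum (map (λ w → f (j ∷ w)) (words k))) (allFin 5))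
sum-words-suc f k = trans (sum-map-concatMap f (λ w → map (_∷ w) (allFin 5)) (words k))
                          (sum-map-comm (λ w j → f (j ∷ w)) (words k) (allFin 5))

words-length : ∀ k → All (λ w → length w ≡ k) (words k)
words-length zero    = refl ∷ []
words-length (suc k) = concat⁺ (map⁺ (All.map
  (λ {w} len → map⁺ {f = _∷ w} (All.universal (λ _ → cong suc len) (allFin 5)))
  (words-length k)))

sum-accepts≡acceptedCount : ∀ q k → sum (map (toℕ ∘ accepts q) (words k)) ≡ acceptedCount q k
sum-accepts≡acceptedCount nothing  k       = sum-map-zero (words k)
sum-accepts≡acceptedCount (just s) zero    = +-identityʳ _
sum-accepts≡acceptedCount (just s) (suc k) =
  trans (sum-words-suc (toℕ ∘ accepts (just s)) k)
        (cong sum (map-cong (λ j → sum-accepts≡acceptedCount (next s j) k) (allFin 5)))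

Chat5-8≡acceptedCount : ∀ n → Chat5 8 n ≡ acceptedCount (just ⟨00000⟩) (5 * n)
Chat5-8≡acceptedCount n = begin
  length (filter (good? 8 n) (words (5 * n)))
    ≡⟨ length-filter≡sum (good? 8 n) (words (5 * n)) ⟩
  sum (map (toℕ ∘ does ∘ good? 8 n) (words (5 * n)))
    ≡⟨ cong sum (map-cong-local (All.map (λ {w} → cong toℕ ∘ does-good w) (words-length (5 * n)))) ⟩
  sum (map (toℕ ∘ accepts (just ⟨00000⟩)) (words (5 * n)))
    ≡⟨ sum-accepts≡acceptedCount (just ⟨00000⟩) (5 * n) ⟩
  acceptedCount (just ⟨00000⟩) (5 * n)
    ∎
  where
  open ≡-Reasoning
  does-good : ∀ w → length w ≡ 5 * n → does (good? 8 n w) ≡ accepts (just ⟨00000⟩) w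
  does-good w len = does-⇔ (good⇔accepts w len) (good? 8 n w) (T? (accepts (just ⟨00000⟩) w))

-- Each step unfolds acceptedCount once: ⟨20000⟩ contributes nothing, and ⟨11110⟩
-- is the only state with two successors.
acceptedCount-⟨10000⟩-5+ : ∀ k → acceptedCount (just ⟨10000⟩) (5 + k) ≡ 2 * acceptedCount (just ⟨10000⟩) k
acceptedCount-⟨10000⟩-5+ k = begin
  N ⟨10000⟩ (5 + k)                   ≡⟨ +-identityʳ _ ⟩
  N ⟨11000⟩ (4 + k)                   ≡⟨ +-identityʳ _ ⟩
  N ⟨11100⟩ (3 + k)                   ≡⟨ +-identityʳ _ ⟩
  N ⟨11110⟩ (2 + k)                   ≡⟨ cong (N ⟨21110⟩ (1 + k) +_) (+-identityʳ _) ⟩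
  N ⟨21110⟩ (1 + k) + N ⟨00000⟩ (1 + k) ≡⟨ cong (_+ N ⟨00000⟩ (1 + k)) (+-identityʳ (N ⟨10000⟩ k)) ⟩
  2 * N ⟨10000⟩ k                     ∎
  where
  open ≡-Reasoning
  N : State → ℕ → ℕ
  N s = acceptedCount (just s)

acceptedCount-⟨10000⟩ : ∀ n → acceptedCount (just ⟨10000⟩) (4 + 5 * n) ≡ 2 ^ n
acceptedCount-⟨10000⟩ zero    = refl
acceptedCount-⟨10000⟩ (suc n) = begin
  acceptedCount (just ⟨10000⟩) (4 + 5 * suc n)    ≡⟨ cong (λ m → acceptedCount (just ⟨10000⟩) (4 + m)) (*-suc 5 n) ⟩
  acceptedCount (just ⟨10000⟩) (5 + (4 + 5 * n))  ≡⟨ acceptedCount-⟨10000⟩-5+ (4 + 5 * n) ⟩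
  2 * acceptedCount (just ⟨10000⟩) (4 + 5 * n)    ≡⟨ cong (2 *_) (acceptedCount-⟨10000⟩ n) ⟩
  2 ^ suc n                                       ∎
  where open ≡-Reasoning

acceptedCount-⟨00000⟩ : ∀ n → acceptedCount (just ⟨00000⟩) (5 * suc n) ≡ 2 ^ n
acceptedCount-⟨00000⟩ n = begin
  acceptedCount (just ⟨00000⟩) (5 * suc n)      ≡⟨ cong (acceptedCount (just ⟨00000⟩)) (*-suc 5 n) ⟩
  acceptedCount (just ⟨10000⟩) (4 + 5 * n) + 0  ≡⟨ +-identityʳ _ ⟩
  acceptedCount (just ⟨10000⟩) (4 + 5 * n)      ≡⟨ acceptedCount-⟨10000⟩ n ⟩
  2 ^ n                                         ∎
  where open ≡-Reasoning

corollary4p9 : (n : ℕ) → 1 ≤ n → Chat5 8 n ≡ 2 ^ (n ∸ 1)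
corollary4p9 (suc n) _ = trans (Chat5-8≡acceptedCount (suc n)) (acceptedCount-⟨00000⟩ n)
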